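{- Let $D$ be a divisible semi-biplane of order $(v,k)$. Then \[\gamma_e(D)\ge v-\frac{v}{\sqrt k+1}.\]
   Context: A semi-biplane is an incidence structure $D=(\mathcal P,\mathcal B)$ (blocks are subsets of $\mathcal P$) such that any two distinct points lie in either $0$ or $2$ common blocks, any two distinct blocks meet in $0$ or $2$ points, and the incidence graph $I(D)$ (bipartite on $\mathcal P\cup\mathcal B$, $P\sim B$ iff $P\in B$) is connected; then $|\mathcal P|=|\mathcal B|=v$ and each point/block is incident with exactly $k$ blocks/points, and $(v,k)$ is its order. The collinearity graph has vertex set $\mathcal P$, distinct points adjacent iff some block contains both; $D$ is divisible if this graph is complete multipartite. $\gamma_e(D)$ is the minimum size of a set $\Gamma$ of edges of $I(D)$ such that every edge of $I(D)$ shares a vertex with some edge of $\Gamma$. -}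

module Defs where

open import Data.Nat using (ℕ; _≤_; _*_; _∸_; _^_)
open import Data.Fin using (Fin)
open import Data.Fin.Subset using (Subset; _∈_; _∩_; ∣_∣)
open import Data.Fin.Subset.Properties using (_∈?_)
open import Data.List using (List; length; filter; allFin)
open import Data.List.Membership.Propositional using () renaming (_∈_ to _∈ₗ_)
open import Data.Product using (_×_; _,_; Σ; ∃; ∃-syntax)
open import Data.Sum using (_⊎_; inj₁; inj₂)
open import Data.Empty using (⊥)
open import Function using (Injective; _⇔_)
open import Relation.Binary.PropositionalEquality using (_≡_; _≢_)
open import Relation.Binary.Construct.Closure.ReflexiveTransitive using (Star)
open import Relation.Nullary using (¬_)
open import Relation.Unary using (Decidable)
open import Relation.Nullary.Decidable using (_×-dec_)

-- An incidence structure with point set Fin v and b blocks; block i is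
-- the subset  blk i  of the point set.  Blocks are subsets, so distinct
-- blocks are distinct subsets (injectivity).
record IncStr (v b : ℕ) : Set where
  field
    blk      : Fin b → Subset v
    blk-inj  : Injective _≡_ _≡_ blk

module _ {v b : ℕ} (D : IncStr v b) where
  open IncStr D

  commonBlocks : Fin v → Fin v → ℕ
  commonBlocks p q =
    length (filter (λ i → (p ∈? blk i) ×-dec (q ∈? blk i)) (allFin b))

  pointDeg : Fin v → ℕ
  pointDeg p = length (filter (λ i → p ∈? blk i) (allFin b))

  Vertex : Set
  Vertex = Fin v ⊎ Fin b

  IAdj : Vertex → Vertex → Set
  IAdj (inj₁ p) (inj₂ i) = p ∈ blk i
  IAdj (inj₂ i) (inj₁ p) = p ∈ blk i
  IAdj (inj₁ _) (inj₁ _) = ⊥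
  IAdj (inj₂ _) (inj₂ _) = ⊥

  IConnected : Set
  IConnected = ∀ x y → Star IAdj x y

  record IsSemiBiplane : Set where
    field
      points-02 : ∀ p q → p ≢ q → commonBlocks p q ≡ 0 ⊎ commonBlocks p q ≡ 2
      blocks-02 : ∀ i j → i ≢ j → ∣ blk i ∩ blk j ∣ ≡ 0 ⊎ ∣ blk i ∩ blk j ∣ ≡ 2
      connected : IConnected

  HasOrder : ℕ → Set
  HasOrder k = b ≡ v × (∀ p → pointDeg p ≡ k) × (∀ i → ∣ blk i ∣ ≡ k)

  Collinear : Fin v → Fin v → Set
  Collinear p q = p ≢ q × ∃[ i ] (p ∈ blk i × q ∈ blk i)

  -- complete multipartite: there is a partition of the points into parts
  -- (labelled by Fin m) such that distinct points are adjacent iff they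
  -- lie in different parts
  Divisible : Set
  Divisible = ∃[ m ] Σ (Fin v → Fin m) λ part →
    ∀ p q → p ≢ q → (Collinear p q ⇔ part p ≢ part q)

  IsEdge : Fin v × Fin b → Set
  IsEdge (p , i) = p ∈ blk i

  IsEdgeDominating : List (Fin v × Fin b) → Set
  IsEdgeDominating Γ =
    (∀ {e} → e ∈ₗ Γ → IsEdge e) ×
    (∀ p i → p ∈ blk i →
       ∃[ p' ] ∃[ i' ] ((p' , i') ∈ₗ Γ × (p' ≡ p ⊎ i' ≡ i)))

-- Let X be the points missed by Γ, a = |X|, and C the blocks met by Γ, c = |C|; then
-- a ≥ v − |Γ|, c ≤ |Γ|, and domination puts every block through a point of X into C.
-- With N the incidence matrix, d = Nᵀ 1_X sums to a k and is supported on C, so by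
-- Cauchy–Schwarz (a k)² ≤ c |d|². Divisibility says N Nᵀ = k I + 2 (J − E) for the same-part
-- matrix E, so all parts have one size n with k² + 2n = 2v + k, and |d|² = k a + 2 (a² − F)
-- where F = Σ |X ∩ part|². Cauchy–Schwarz for r ↦ |X ∩ part(r)| gives v F ≥ n a².
-- Eliminating |d|², F and n leaves k a (v − c) ≤ (v − a) c, whence k (v − |Γ|)² ≤ |Γ|².
module Submission where

open import Defs
open import Data.Nat using (ℕ; _≤_; _*_; _∸_; _^_)
open import Data.Fin using (Fin)
open import Data.List using (List; length)
open import Data.Product using (_×_)

open import Data.Nat using (zero; suc; _+_; _<_; z≤n; s≤s)
open import Data.Nat.Properties hiding (_≟_)
open import Algebra.Properties.Semiring.Sum +-*-semiring
  using (sum; sum-syntax; sum-cong-≗; sum-replicate-zero; ∑-distrib-+; ∑-comm; *-distribˡ-sum; *-distribʳ-sum)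
open import Algebra.Properties.CommutativeSemigroup *-commutativeSemigroup
  using (x∙yz≈y∙xz) renaming (interchange to *-interchange)
open import Data.Nat.Tactic.RingSolver using (solve; solve-∀)
open import Data.Fin using (zero; suc)
open import Data.Fin.Properties using (_≟_)
open import Data.Fin.Subset using (Subset; inside; outside; ∣_∣; _∈_)
open import Data.Fin.Subset.Properties using (_∈?_)
open import Data.List using ([]; _∷_; map; filter; tabulate)
open import Data.List.Membership.Propositional using () renaming (_∈_ to _∈ₗ_)
open import Data.List.Membership.Propositional.Properties using (∈-map⁺)
import Data.List.Membership.DecPropositional as DecMembership
open import Data.List.Properties using (length-map)
open import Data.Product using (_,_; proj₁; proj₂)
open import Data.Sum using (_⊎_; inj₁; inj₂; [_,_]′)
open import Data.Empty using (⊥-elim)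
import Data.Vec as Vec
open import Function using (id; _∘_; _⇔_; Equivalence)
open import Relation.Nullary using (Dec; yes; no; contradiction; map′)
open import Relation.Nullary.Decidable using (_×-dec_; ¬?)
open import Relation.Unary using (Decidable)
open import Relation.Binary.PropositionalEquality

variable
  A : Set
  P Q : Set
  n : ℕ

infix 4 _∈ₗ?_
_∈ₗ?_ : (x : Fin n) (xs : List (Fin n)) → Dec (x ∈ₗ xs)
_∈ₗ?_ = DecMembership._∈?_ _≟_

𝟙 : Dec P → ℕ
𝟙 (yes _) = 1
𝟙 (no _)  = 0

𝟙-yes : (P? : Dec P) → P → 𝟙 P? ≡ 1
𝟙-yes (yes _) _  = refl
𝟙-yes (no ¬p) p = contradiction p ¬p

𝟙-idem : (P? : Dec P) → 𝟙 P? * 𝟙 P? ≡ 𝟙 P?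
𝟙-idem (yes _) = refl
𝟙-idem (no _)  = refl

𝟙-map′ : ∀ {f : P → Q} {g : Q → P} (P? : Dec P) → 𝟙 (map′ f g P?) ≡ 𝟙 P?
𝟙-map′ (yes _) = refl
𝟙-map′ (no _)  = refl

𝟙-×-dec : (P? : Dec P) (Q? : Dec Q) → 𝟙 (P? ×-dec Q?) ≡ 𝟙 P? * 𝟙 Q?
𝟙-×-dec (yes _) (yes _) = refl
𝟙-×-dec (yes _) (no _)  = refl
𝟙-×-dec (no _)  _       = refl

𝟙-¬?+𝟙 : (P? : Dec P) → 𝟙 (¬? P?) + 𝟙 P? ≡ 1
𝟙-¬?+𝟙 (yes _) = refl
𝟙-¬?+𝟙 (no _)  = refl

sum-const : ∀ n c → ∑[ i < n ] c ≡ n * c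
sum-const zero    c = refl
sum-const (suc n) c = cong (c +_) (sum-const n c)

sum-mono-≤ : {f g : Fin n → ℕ} → (∀ i → f i ≤ g i) → sum f ≤ sum g
sum-mono-≤ {zero}  f≤g = z≤n
sum-mono-≤ {suc n} f≤g = +-mono-≤ (f≤g zero) (sum-mono-≤ (f≤g ∘ suc))

term≤sum : (f : Fin n → ℕ) (i : Fin n) → f i ≤ sum f
term≤sum f zero    = m≤m+n _ _
term≤sum f (suc i) = ≤-trans (term≤sum (f ∘ suc) i) (m≤n+m _ _)

sum-𝟙≟* : (i : Fin n) (f : Fin n → ℕ) → ∑[ j < n ] (𝟙 (i ≟ j) * f j) ≡ f i
sum-𝟙≟* {suc n} zero f = begin
  f zero + 0 + ∑[ j < n ] 0 ≡⟨ cong (f zero + 0 +_) (sum-replicate-zero n) ⟩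
  f zero + 0 + 0             ≡⟨ trans (+-identityʳ _) (+-identityʳ _) ⟩
  f zero                     ∎
  where open ≡-Reasoning
sum-𝟙≟* {suc n} (suc i) f =
  trans (sum-cong-≗ (λ j → cong (_* f (suc j)) (𝟙-map′ (i ≟ j)))) (sum-𝟙≟* i (f ∘ suc))

sum-𝟙≟ : (i : Fin n) → ∑[ j < n ] 𝟙 (i ≟ j) ≡ 1
sum-𝟙≟ i = trans (sum-cong-≗ (λ j → sym (*-identityʳ (𝟙 (i ≟ j))))) (sum-𝟙≟* i (λ _ → 1))

sum-𝟙-tabulate : {R : A → Set} (R? : Decidable R) (f : Fin n → A) →
  length (filter R? (tabulate f)) ≡ ∑[ i < n ] 𝟙 (R? (f i))
sum-𝟙-tabulate {n = zero}  R? f = refl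
sum-𝟙-tabulate {n = suc n} R? f with R? (f zero)
... | yes _ = cong suc (sum-𝟙-tabulate R? (f ∘ suc))
... | no _  = sum-𝟙-tabulate R? (f ∘ suc)

∣p∣≡sum-𝟙∈ : (p : Subset n) → ∣ p ∣ ≡ ∑[ i < n ] 𝟙 (i ∈? p)
∣p∣≡sum-𝟙∈ Vec.[]            = refl
∣p∣≡sum-𝟙∈ (inside Vec.∷ p)  = cong suc (trans (∣p∣≡sum-𝟙∈ p) (sum-cong-≗ (λ i → sym (𝟙-map′ (i ∈? p)))))
∣p∣≡sum-𝟙∈ (outside Vec.∷ p) = trans (∣p∣≡sum-𝟙∈ p) (sum-cong-≗ (λ i → sym (𝟙-map′ (i ∈? p))))

sum-𝟙∈ₗ≤length : (xs : List (Fin n)) → ∑[ i < n ] 𝟙 (i ∈ₗ? xs) ≤ length xs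
sum-𝟙∈ₗ≤length {n} [] = ≤-reflexive (sum-replicate-zero n)
sum-𝟙∈ₗ≤length {n} (x ∷ xs) = begin
  ∑[ i < n ] 𝟙 (i ∈ₗ? x ∷ xs)                      ≤⟨ sum-mono-≤ 𝟙∈∷≤ ⟩
  ∑[ i < n ] (𝟙 (x ≟ i) + 𝟙 (i ∈ₗ? xs))            ≡⟨ ∑-distrib-+ {n} _ _ ⟩
  ∑[ i < n ] 𝟙 (x ≟ i) + ∑[ i < n ] 𝟙 (i ∈ₗ? xs)   ≤⟨ +-mono-≤ (≤-reflexive (sum-𝟙≟ x)) (sum-𝟙∈ₗ≤length xs) ⟩
  suc (length xs)                                   ∎
  where
  open ≤-Reasoning
  𝟙∈∷≤ : ∀ i → 𝟙 (i ∈ₗ? x ∷ xs) ≤ 𝟙 (x ≟ i) + 𝟙 (i ∈ₗ? xs)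
  𝟙∈∷≤ i with i ≟ x | i ∈ₗ? xs | x ≟ i
  ... | no _     | no _  | _      = z≤n
  ... | no _     | yes _ | x≟i    = m≤n+m 1 (𝟙 x≟i)
  ... | yes _    | _     | yes _  = s≤s z≤n
  ... | yes refl | _     | no x≢x = contradiction refl x≢x

sum-𝟙∉ₗ+sum-𝟙∈ₗ : (xs : List (Fin n)) → ∑[ i < n ] 𝟙 (¬? (i ∈ₗ? xs)) + ∑[ i < n ] 𝟙 (i ∈ₗ? xs) ≡ n
sum-𝟙∉ₗ+sum-𝟙∈ₗ {n} xs = begin
  ∑[ i < n ] 𝟙 (¬? (i ∈ₗ? xs)) + ∑[ i < n ] 𝟙 (i ∈ₗ? xs) ≡⟨ ∑-distrib-+ {n} _ _ ⟨
  ∑[ i < n ] (𝟙 (¬? (i ∈ₗ? xs)) + 𝟙 (i ∈ₗ? xs))       ≡⟨ sum-cong-≗ (λ i → 𝟙-¬?+𝟙 (i ∈ₗ? xs)) ⟩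
  ∑[ i < n ] 1                                         ≡⟨ sum-const n 1 ⟩
  n * 1                                                ≡⟨ *-identityʳ n ⟩
  n                                                    ∎
  where open ≡-Reasoning

∸-length≤sum-𝟙∉ₗ : (xs : List (Fin n)) → n ∸ length xs ≤ ∑[ i < n ] 𝟙 (¬? (i ∈ₗ? xs))
∸-length≤sum-𝟙∉ₗ {n} xs = begin
  n ∸ length xs ≤⟨ ∸-monoʳ-≤ n (sum-𝟙∈ₗ≤length xs) ⟩
  n ∸ in-xs      ≡⟨ cong (_∸ in-xs) (sum-𝟙∉ₗ+sum-𝟙∈ₗ xs) ⟨
  out-xs + in-xs ∸ in-xs ≡⟨ m+n∸n≡m out-xs in-xs ⟩
  out-xs         ∎
  where
  open ≤-Reasoning
  out-xs = ∑[ i < n ] 𝟙 (¬? (i ∈ₗ? xs))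
  in-xs = ∑[ i < n ] 𝟙 (i ∈ₗ? xs)

∸-sum-𝟙∉ₗ≤length : (xs : List (Fin n)) → n ∸ ∑[ i < n ] 𝟙 (¬? (i ∈ₗ? xs)) ≤ length xs
∸-sum-𝟙∉ₗ≤length {n} xs = begin
  n ∸ out-xs              ≡⟨ cong (_∸ out-xs) (sum-𝟙∉ₗ+sum-𝟙∈ₗ xs) ⟨
  out-xs + in-xs ∸ out-xs ≡⟨ m+n∸m≡n out-xs in-xs ⟩
  in-xs                   ≤⟨ sum-𝟙∈ₗ≤length xs ⟩
  length xs               ∎
  where
  open ≤-Reasoning
  out-xs = ∑[ i < n ] 𝟙 (¬? (i ∈ₗ? xs))
  in-xs = ∑[ i < n ] 𝟙 (i ∈ₗ? xs)

m^2≡m*m : ∀ m → m ^ 2 ≡ m * m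
m^2≡m*m m = cong (m *_) (*-identityʳ m)

*-idem⇒≤1 : ∀ {m} → m * m ≡ m → m ≤ 1
*-idem⇒≤1 {zero}  _     = z≤n
*-idem⇒≤1 {suc m} m²≡m = ≤-reflexive (*-cancelʳ-≡ (suc m) 1 (suc m) (trans m²≡m (sym (*-identityˡ (suc m)))))

sum-idem≤length : {f : Fin n → ℕ} → (∀ i → f i * f i ≡ f i) → sum f ≤ n
sum-idem≤length {n} f-idem =
  ≤-trans (sum-mono-≤ (*-idem⇒≤1 ∘ f-idem)) (≤-reflexive (trans (sum-const n 1) (*-identityʳ n)))

m*n+m*n≤m*m+n*n : ∀ m n → m * n + m * n ≤ m * m + n * n
m*n+m*n≤m*m+n*n m n = [ ordered , reversed ]′ (≤-total m n)
  where
  ordered : ∀ {m n} → m ≤ n → m * n + m * n ≤ m * m + n * n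
  ordered {m} m≤n with m≤n⇒∃[o]m+o≡n m≤n
  ... | d , refl = begin
    m * (m + d) + m * (m + d)           ≡⟨ solve (m ∷ d ∷ []) ⟩
    m * m + (m * m + 2 * m * d) + 0     ≤⟨ +-monoʳ-≤ _ z≤n ⟩
    m * m + (m * m + 2 * m * d) + d * d ≡⟨ solve (m ∷ d ∷ []) ⟩
    m * m + (m + d) * (m + d)           ∎
    where open ≤-Reasoning
  reversed : n ≤ m → m * n + m * n ≤ m * m + n * n
  reversed n≤m = subst₂ _≤_ (cong₂ _+_ (*-comm n m) (*-comm n m)) (+-comm (n * n) (m * m)) (ordered n≤m)

m+m≤n+n⇒m≤n : ∀ {m n} → m + m ≤ n + n → m ≤ n
m+m≤n+n⇒m≤n {m} {n} m+m≤n+n = *-cancelˡ-≤ 2 (begin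
  2 * m ≡⟨ solve (m ∷ []) ⟩
  m + m ≤⟨ m+m≤n+n ⟩
  n + n ≡⟨ solve (n ∷ []) ⟩
  2 * n ∎)
  where open ≤-Reasoning

sum*sum : ∀ {m} (f : Fin m → ℕ) (g : Fin n → ℕ) → sum f * sum g ≡ ∑[ i < m ] ∑[ j < n ] (f i * g j)
sum*sum f g = trans (*-distribʳ-sum (sum g) f) (sum-cong-≗ (λ i → *-distribˡ-sum (f i) g))

∑∑-distrib-+ : ∀ {m n} (f g : Fin m → Fin n → ℕ) →
  ∑[ i < m ] ∑[ j < n ] (f i j + g i j) ≡ ∑[ i < m ] ∑[ j < n ] f i j + ∑[ i < m ] ∑[ j < n ] g i j
∑∑-distrib-+ {m} {n} f g = trans (sum-cong-≗ (λ i → ∑-distrib-+ {n} (f i) (g i))) (∑-distrib-+ {m} _ _)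

*-distribˡ-∑∑ : ∀ {m n} c (f : Fin m → Fin n → ℕ) →
  c * ∑[ i < m ] ∑[ j < n ] f i j ≡ ∑[ i < m ] ∑[ j < n ] (c * f i j)
*-distribˡ-∑∑ {m} {n} c f = trans (*-distribˡ-sum {m} c _) (sum-cong-≗ (λ i → *-distribˡ-sum c (f i)))

cauchy-schwarz : (f g : Fin n → ℕ) →
  ∑[ i < n ] (f i * g i) * ∑[ i < n ] (f i * g i) ≤ ∑[ i < n ] (f i * f i) * ∑[ i < n ] (g i * g i)
cauchy-schwarz {n} f g = m+m≤n+n⇒m≤n (begin
  s * s + s * s
    ≡⟨ cong₂ _+_ (sum*sum fg fg) (sum*sum fg fg) ⟩
  ∑[ i < n ] ∑[ j < n ] (fg i * fg j) + ∑[ i < n ] ∑[ j < n ] (fg i * fg j)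
    ≡⟨ ∑∑-distrib-+ {n} {n} _ _ ⟨
  ∑[ i < n ] ∑[ j < n ] (fg i * fg j + fg i * fg j)
    ≡⟨ sum-cong-≗ (λ i → sum-cong-≗ (λ j → swap-factors (f i) (g i) (f j) (g j))) ⟩
  ∑[ i < n ] ∑[ j < n ] (f i * g j * (f j * g i) + f i * g j * (f j * g i))
    ≤⟨ sum-mono-≤ (λ i → sum-mono-≤ (λ j → m*n+m*n≤m*m+n*n (f i * g j) (f j * g i))) ⟩
  ∑[ i < n ] ∑[ j < n ] (f i * g j * (f i * g j) + f j * g i * (f j * g i))
    ≡⟨ sum-cong-≗ (λ i → sum-cong-≗ (λ j → regroup (f i) (g i) (f j) (g j))) ⟩
  ∑[ i < n ] ∑[ j < n ] (f² i * g² j + g² i * f² j)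
    ≡⟨ ∑∑-distrib-+ {n} {n} _ _ ⟩
  ∑[ i < n ] ∑[ j < n ] (f² i * g² j) + ∑[ i < n ] ∑[ j < n ] (g² i * f² j)
    ≡⟨ cong₂ _+_ (sum*sum f² g²) (sum*sum g² f²) ⟨
  sum f² * sum g² + sum g² * sum f²
    ≡⟨ cong (sum f² * sum g² +_) (*-comm (sum g²) (sum f²)) ⟩
  sum f² * sum g² + sum f² * sum g² ∎)
  where
  open ≤-Reasoning
  fg f² g² : Fin n → ℕ
  fg i = f i * g i
  f² i = f i * f i
  g² i = g i * g i
  s = sum fg
  swap-factors : ∀ a b c d → a * b * (c * d) + a * b * (c * d) ≡ a * d * (c * b) + a * d * (c * b)
  swap-factors = solve-∀
  regroup : ∀ a b c d → a * d * (a * d) + c * b * (c * b) ≡ a * a * (d * d) + b * b * (c * c)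
  regroup = solve-∀

cauchy-schwarz-on-support : (w f : Fin n → ℕ) → (∀ i → w i * w i ≡ w i) → (∀ i → w i * f i ≡ f i) →
  sum f * sum f ≤ sum w * ∑[ i < n ] (f i * f i)
cauchy-schwarz-on-support w f w-idem f-on-w =
  subst₂ _≤_ (cong₂ _*_ ∑wf≡∑f ∑wf≡∑f) (cong (_* _) (sum-cong-≗ w-idem)) (cauchy-schwarz w f)
  where
  ∑wf≡∑f = sum-cong-≗ f-on-w

o*m≤o*n⇒o≡0⊎m≤n : ∀ o {m n} → o * m ≤ o * n → o ≡ 0 ⊎ m ≤ n
o*m≤o*n⇒o≡0⊎m≤n zero    _  = inj₁ refl
o*m≤o*n⇒o≡0⊎m≤n (suc o) le = inj₂ (*-cancelˡ-≤ (suc o) le)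

double-counting-arithmetic : ∀ {v k a r a' c S₂ F n} →
  a + r ≡ v → a' + c ≡ v → k * k + 2 * n ≡ 2 * v + k →
  a * k * (a * k) ≤ c * S₂ → S₂ + 2 * F ≡ 2 * (a * a) + k * a → n * (a * a) ≤ v * F →
  k * a * a' ≤ r * c
double-counting-arithmetic {v} {k} {a} {r} {a'} {c} {S₂} {F} {n} a+r≡v a'+c≡v part-size cs pairs spread
  with o*m≤o*n⇒o≡0⊎m≤n (k * a) (+-cancelʳ-≤ (2 * c * v * (a * a)) _ _ moved)
  where
  open ≤-Reasoning
  -- v · cs + 2c · spread, rewritten with pairs and part-size; c k² a² and 2 c v a² are
  -- carried on both sides so that no subtraction occurs.
  moved : k * a * (v * k * a + c * a) + 2 * c * v * (a * a) ≤ k * a * (c * v + c * k * a) + 2 * c * v * (a * a)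
  moved = begin
    k * a * (v * k * a + c * a) + 2 * c * v * (a * a)
      ≡⟨ solve (v ∷ k ∷ a ∷ c ∷ []) ⟩
    v * (a * k * (a * k)) + c * (a * a) * (2 * v + k)
      ≡⟨ cong (λ t → v * (a * k * (a * k)) + c * (a * a) * t) part-size ⟨
    v * (a * k * (a * k)) + c * (a * a) * (k * k + 2 * n)
      ≡⟨ solve (v ∷ k ∷ a ∷ c ∷ n ∷ []) ⟩
    v * (a * k * (a * k)) + c * 2 * (n * (a * a)) + c * (a * a) * (k * k)
      ≤⟨ +-monoˡ-≤ _ (+-mono-≤ (*-monoʳ-≤ v cs) (*-monoʳ-≤ (c * 2) spread)) ⟩
    v * (c * S₂) + c * 2 * (v * F) + c * (a * a) * (k * k)
      ≡⟨ solve (v ∷ k ∷ a ∷ c ∷ S₂ ∷ F ∷ []) ⟩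
    c * v * (S₂ + 2 * F) + c * (a * a) * (k * k)
      ≡⟨ cong (λ t → c * v * t + c * (a * a) * (k * k)) pairs ⟩
    c * v * (2 * (a * a) + k * a) + c * (a * a) * (k * k)
      ≡⟨ solve (v ∷ k ∷ a ∷ c ∷ []) ⟩
    k * a * (c * v + c * k * a) + 2 * c * v * (a * a) ∎
... | inj₁ ka≡0 = ≤-trans (≤-reflexive (cong (_* a') ka≡0)) z≤n
... | inj₂ vka+ca≤cv+cka = +-cancelʳ-≤ (c * k * a + c * a) _ _ (begin
    k * a * a' + (c * k * a + c * a) ≡⟨ solve (k ∷ a ∷ a' ∷ c ∷ []) ⟩
    (a' + c) * k * a + c * a         ≡⟨ cong (λ t → t * k * a + c * a) a'+c≡v ⟩
    v * k * a + c * a                ≤⟨ vka+ca≤cv+cka ⟩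
    c * v + c * k * a                ≡⟨ cong (λ t → c * t + c * k * a) a+r≡v ⟨
    c * (a + r) + c * k * a          ≡⟨ solve (k ∷ a ∷ r ∷ c ∷ []) ⟩
    r * c + (c * k * a + c * a)      ∎)
  where open ≤-Reasoning

-- gram is N Nᵀ = k I + 2 (J − E), E the same-part matrix, with the 2E moved to the left.
module DivisibleIncidenceMatrix {v m k : ℕ} (N : Fin v → Fin v → ℕ) (part : Fin v → Fin m)
  (row-sum : ∀ p → ∑[ i < v ] N p i ≡ k)
  (column-sum : ∀ i → ∑[ p < v ] N p i ≡ k)
  (gram : ∀ p q → ∑[ i < v ] (N p i * N q i) + 2 * 𝟙 (part p ≟ part q) ≡ 2 + k * 𝟙 (p ≟ q))
  where

  samePart : Fin v → Fin v → ℕ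
  samePart p q = 𝟙 (part p ≟ part q)

  partSize : Fin v → ℕ
  partSize p = ∑[ q < v ] samePart p q

  samePart-trans : ∀ p q r → samePart p r * samePart q r ≡ samePart p q * samePart p r
  samePart-trans p q r with part p ≟ part r | part q ≟ part r | part p ≟ part q
  ... | yes _  | yes _  | yes _  = refl
  ... | yes pr | yes qr | no ¬pq = contradiction (trans pr (sym qr)) ¬pq
  ... | yes pr | no ¬qr | yes pq = contradiction (trans (sym pq) pr) ¬qr
  ... | yes _  | no _   | no _   = refl
  ... | no _   | _      | pq?    = sym (*-zeroʳ (𝟙 pq?))

  sum-gram-row : ∀ p → ∑[ q < v ] ∑[ i < v ] (N p i * N q i) ≡ k * k
  sum-gram-row p = begin
    ∑[ q < v ] ∑[ i < v ] (N p i * N q i) ≡⟨ ∑-comm {v} {v} _ ⟩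
    ∑[ i < v ] ∑[ q < v ] (N p i * N q i) ≡⟨ sum-cong-≗ (λ i → *-distribˡ-sum (N p i) (λ q → N q i)) ⟨
    ∑[ i < v ] (N p i * ∑[ q < v ] N q i) ≡⟨ sum-cong-≗ (λ i → cong (N p i *_) (column-sum i)) ⟩
    ∑[ i < v ] (N p i * k)                ≡⟨ *-distribʳ-sum k (N p) ⟨
    ∑[ i < v ] N p i * k                  ≡⟨ cong (_* k) (row-sum p) ⟩
    k * k                                 ∎
    where open ≡-Reasoning

  partSize-equation : ∀ p → k * k + 2 * partSize p ≡ 2 * v + k
  partSize-equation p = begin
    k * k + 2 * partSize p
      ≡⟨ cong₂ _+_ (sum-gram-row p) (sym (*-distribˡ-sum 2 (samePart p))) ⟨
    ∑[ q < v ] ∑[ i < v ] (N p i * N q i) + ∑[ q < v ] (2 * samePart p q)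
      ≡⟨ ∑-distrib-+ {v} _ _ ⟨
    ∑[ q < v ] (∑[ i < v ] (N p i * N q i) + 2 * samePart p q)
      ≡⟨ sum-cong-≗ (gram p) ⟩
    ∑[ q < v ] (2 + k * 𝟙 (p ≟ q))
      ≡⟨ ∑-distrib-+ {v} _ _ ⟩
    ∑[ q < v ] 2 + ∑[ q < v ] (k * 𝟙 (p ≟ q))
      ≡⟨ cong₂ _+_ (sum-const v 2) (trans (sym (*-distribˡ-sum k (λ q → 𝟙 (p ≟ q)))) (cong (k *_) (sum-𝟙≟ p))) ⟩
    v * 2 + k * 1
      ≡⟨ solve (v ∷ k ∷ []) ⟩
    2 * v + k ∎
    where open ≡-Reasoning

  partSize-constant : ∀ p q → partSize p ≡ partSize q
  partSize-constant p q =
    *-cancelˡ-≡ _ _ 2 (+-cancelˡ-≡ (k * k) _ _ (trans (partSize-equation p) (sym (partSize-equation q))))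

  module _ (x : Fin v → ℕ) (x-idem : ∀ p → x p * x p ≡ x p) where

    a : ℕ
    a = sum x

    F : ℕ
    F = ∑[ p < v ] ∑[ q < v ] (x p * x q * samePart p q)

    countInPart : Fin v → ℕ
    countInPart r = ∑[ q < v ] (x q * samePart q r)

    sum-countInPart : ∀ p₀ → sum countInPart ≡ partSize p₀ * a
    sum-countInPart p₀ = begin
      ∑[ r < v ] ∑[ q < v ] (x q * samePart q r) ≡⟨ ∑-comm {v} {v} _ ⟩
      ∑[ q < v ] ∑[ r < v ] (x q * samePart q r) ≡⟨ sum-cong-≗ (λ q → *-distribˡ-sum (x q) (samePart q)) ⟨
      ∑[ q < v ] (x q * partSize q)              ≡⟨ sum-cong-≗ (λ q → cong (x q *_) (partSize-constant q p₀)) ⟩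
      ∑[ q < v ] (x q * partSize p₀)             ≡⟨ *-distribʳ-sum (partSize p₀) x ⟨
      a * partSize p₀                            ≡⟨ *-comm a (partSize p₀) ⟩
      partSize p₀ * a                            ∎
      where open ≡-Reasoning

    sum-samePart*samePart : ∀ p₀ q q′ → ∑[ r < v ] (x q * samePart q r * (x q′ * samePart q′ r))
      ≡ partSize p₀ * (x q * x q′ * samePart q q′)
    sum-samePart*samePart p₀ q q′ = begin
      ∑[ r < v ] (x q * samePart q r * (x q′ * samePart q′ r))
        ≡⟨ sum-cong-≗ (λ r → trans (*-interchange (x q) _ (x q′) _) (cong (x q * x q′ *_) (samePart-trans q q′ r))) ⟩
      ∑[ r < v ] (x q * x q′ * (samePart q q′ * samePart q r))
        ≡⟨ *-distribˡ-sum (x q * x q′) (λ r → samePart q q′ * samePart q r) ⟨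
      x q * x q′ * ∑[ r < v ] (samePart q q′ * samePart q r)
        ≡⟨ cong (x q * x q′ *_) (*-distribˡ-sum (samePart q q′) (samePart q)) ⟨
      x q * x q′ * (samePart q q′ * partSize q)
        ≡⟨ cong (λ t → x q * x q′ * (samePart q q′ * t)) (partSize-constant q p₀) ⟩
      x q * x q′ * (samePart q q′ * partSize p₀)
        ≡⟨ *-assoc (x q * x q′) _ _ ⟨
      x q * x q′ * samePart q q′ * partSize p₀
        ≡⟨ *-comm _ (partSize p₀) ⟩
      partSize p₀ * (x q * x q′ * samePart q q′) ∎
      where open ≡-Reasoning

    sum-countInPart² : ∀ p₀ → ∑[ r < v ] (countInPart r * countInPart r) ≡ partSize p₀ * F
    sum-countInPart² p₀ = begin
      ∑[ r < v ] (countInPart r * countInPart r)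
        ≡⟨ sum-cong-≗ (λ r → sum*sum (λ q → x q * samePart q r) (λ q′ → x q′ * samePart q′ r)) ⟩
      ∑[ r < v ] ∑[ q < v ] ∑[ q′ < v ] (x q * samePart q r * (x q′ * samePart q′ r))
        ≡⟨ ∑-comm {v} {v} _ ⟩
      ∑[ q < v ] ∑[ r < v ] ∑[ q′ < v ] (x q * samePart q r * (x q′ * samePart q′ r))
        ≡⟨ sum-cong-≗ (λ q → ∑-comm {v} {v} (λ r q′ → x q * samePart q r * (x q′ * samePart q′ r))) ⟩
      ∑[ q < v ] ∑[ q′ < v ] ∑[ r < v ] (x q * samePart q r * (x q′ * samePart q′ r))
        ≡⟨ sum-cong-≗ (λ q → sum-cong-≗ (λ q′ → sum-samePart*samePart p₀ q q′)) ⟩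
      ∑[ q < v ] ∑[ q′ < v ] (partSize p₀ * (x q * x q′ * samePart q q′))
        ≡⟨ *-distribˡ-∑∑ {v} {v} (partSize p₀) _ ⟨
      partSize p₀ * F ∎
      where open ≡-Reasoning

    partSize*a²≤v*F : ∀ p₀ → partSize p₀ * (a * a) ≤ v * F
    partSize*a²≤v*F p₀ with o*m≤o*n⇒o≡0⊎m≤n (partSize p₀) (begin
        partSize p₀ * (partSize p₀ * (a * a))
          ≡⟨ square-of-product (partSize p₀) a ⟩
        (partSize p₀ * a) * (partSize p₀ * a)
          ≡⟨ cong₂ _*_ (sum-countInPart p₀) (sum-countInPart p₀) ⟨
        sum countInPart * sum countInPart
          ≤⟨ cauchy-schwarz-on-support (λ _ → 1) countInPart (λ _ → refl) (λ r → *-identityˡ (countInPart r)) ⟩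
        ∑[ r < v ] 1 * ∑[ r < v ] (countInPart r * countInPart r)
          ≡⟨ cong₂ _*_ (trans (sum-const v 1) (*-identityʳ v)) (sum-countInPart² p₀) ⟩
        v * (partSize p₀ * F)
          ≡⟨ x∙yz≈y∙xz v (partSize p₀) F ⟩
        partSize p₀ * (v * F) ∎)
      where
      open ≤-Reasoning
      square-of-product : ∀ s t → s * (s * (t * t)) ≡ s * t * (s * t)
      square-of-product = solve-∀
    ... | inj₁ size≡0      = ≤-trans (≤-reflexive (cong (_* (a * a)) size≡0)) z≤n
    ... | inj₂ size*a²≤v*F = size*a²≤v*F

    d : Fin v → ℕ
    d i = ∑[ p < v ] (x p * N p i)

    sum-d : sum d ≡ a * k
    sum-d = begin
      ∑[ i < v ] ∑[ p < v ] (x p * N p i) ≡⟨ ∑-comm {v} {v} _ ⟩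
      ∑[ p < v ] ∑[ i < v ] (x p * N p i) ≡⟨ sum-cong-≗ (λ p → *-distribˡ-sum (x p) (N p)) ⟨
      ∑[ p < v ] (x p * ∑[ i < v ] N p i) ≡⟨ sum-cong-≗ (λ p → cong (x p *_) (row-sum p)) ⟩
      ∑[ p < v ] (x p * k)                ≡⟨ *-distribʳ-sum k x ⟨
      a * k                               ∎
      where open ≡-Reasoning

    sum-d² : ∑[ i < v ] (d i * d i) ≡ ∑[ p < v ] ∑[ q < v ] (x p * x q * ∑[ i < v ] (N p i * N q i))
    sum-d² = begin
      ∑[ i < v ] (d i * d i)
        ≡⟨ sum-cong-≗ (λ i → sum*sum (λ p → x p * N p i) (λ q → x q * N q i)) ⟩
      ∑[ i < v ] ∑[ p < v ] ∑[ q < v ] (x p * N p i * (x q * N q i))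
        ≡⟨ ∑-comm {v} {v} _ ⟩
      ∑[ p < v ] ∑[ i < v ] ∑[ q < v ] (x p * N p i * (x q * N q i))
        ≡⟨ sum-cong-≗ (λ p → ∑-comm {v} {v} (λ i q → x p * N p i * (x q * N q i))) ⟩
      ∑[ p < v ] ∑[ q < v ] ∑[ i < v ] (x p * N p i * (x q * N q i))
        ≡⟨ sum-cong-≗ (λ p → sum-cong-≗ (λ q → sum-cong-≗ (λ i → *-interchange (x p) (N p i) (x q) (N q i)))) ⟩
      ∑[ p < v ] ∑[ q < v ] ∑[ i < v ] (x p * x q * (N p i * N q i))
        ≡⟨ sum-cong-≗ (λ p → sum-cong-≗ (λ q → *-distribˡ-sum (x p * x q) (λ i → N p i * N q i))) ⟨
      ∑[ p < v ] ∑[ q < v ] (x p * x q * ∑[ i < v ] (N p i * N q i)) ∎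
      where open ≡-Reasoning

    quadratic-form : ∑[ p < v ] ∑[ q < v ] (x p * x q * (2 + k * 𝟙 (p ≟ q))) ≡ 2 * (a * a) + k * a
    quadratic-form = begin
      ∑[ p < v ] ∑[ q < v ] (x p * x q * (2 + k * 𝟙 (p ≟ q))) ≡⟨ sum-cong-≗ row ⟩
      ∑[ p < v ] (2 * a * x p + k * x p)                      ≡⟨ ∑-distrib-+ {v} _ _ ⟩
      ∑[ p < v ] (2 * a * x p) + ∑[ p < v ] (k * x p)
        ≡⟨ cong₂ _+_ (*-distribˡ-sum (2 * a) x) (*-distribˡ-sum k x) ⟨
      2 * a * a + k * a                                       ≡⟨ cong (_+ k * a) (*-assoc 2 a a) ⟩
      2 * (a * a) + k * a                                     ∎
      where
      open ≡-Reasoning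
      expand : ∀ s t u w → s * t * (2 + u * w) ≡ 2 * s * t + u * s * (w * t)
      expand = solve-∀
      double-swap : ∀ s t → 2 * s * t ≡ 2 * t * s
      double-swap = solve-∀
      row : ∀ p → ∑[ q < v ] (x p * x q * (2 + k * 𝟙 (p ≟ q))) ≡ 2 * a * x p + k * x p
      row p = begin
        ∑[ q < v ] (x p * x q * (2 + k * 𝟙 (p ≟ q)))
          ≡⟨ sum-cong-≗ (λ q → expand (x p) (x q) k (𝟙 (p ≟ q))) ⟩
        ∑[ q < v ] (2 * x p * x q + k * x p * (𝟙 (p ≟ q) * x q))
          ≡⟨ ∑-distrib-+ {v} _ _ ⟩
        ∑[ q < v ] (2 * x p * x q) + ∑[ q < v ] (k * x p * (𝟙 (p ≟ q) * x q))
          ≡⟨ cong₂ _+_ (*-distribˡ-sum (2 * x p) x) (*-distribˡ-sum (k * x p) (λ q → 𝟙 (p ≟ q) * x q)) ⟨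
        2 * x p * a + k * x p * ∑[ q < v ] (𝟙 (p ≟ q) * x q)
          ≡⟨ cong (λ t → 2 * x p * a + k * x p * t) (sum-𝟙≟* p x) ⟩
        2 * x p * a + k * x p * x p
          ≡⟨ cong₂ _+_ (double-swap (x p) a) (trans (*-assoc k (x p) (x p)) (cong (k *_) (x-idem p))) ⟩
        2 * a * x p + k * x p ∎

    sum-d²+2F : ∑[ i < v ] (d i * d i) + 2 * F ≡ 2 * (a * a) + k * a
    sum-d²+2F = begin
      ∑[ i < v ] (d i * d i) + 2 * F
        ≡⟨ cong₂ _+_ sum-d² (*-distribˡ-∑∑ {v} {v} 2 _) ⟩
      ∑[ p < v ] ∑[ q < v ] (x p * x q * ∑[ i < v ] (N p i * N q i))
        + ∑[ p < v ] ∑[ q < v ] (2 * (x p * x q * samePart p q))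
        ≡⟨ ∑∑-distrib-+ {v} {v} _ _ ⟨
      ∑[ p < v ] ∑[ q < v ] (x p * x q * ∑[ i < v ] (N p i * N q i) + 2 * (x p * x q * samePart p q))
        ≡⟨ sum-cong-≗ (λ p → sum-cong-≗ (λ q →
             trans (factor (x p * x q) _ (samePart p q)) (cong (x p * x q *_) (gram p q)))) ⟩
      ∑[ p < v ] ∑[ q < v ] (x p * x q * (2 + k * 𝟙 (p ≟ q)))
        ≡⟨ quadratic-form ⟩
      2 * (a * a) + k * a ∎
      where
      open ≡-Reasoning
      factor : ∀ s t u → s * t + 2 * (s * u) ≡ s * (t + 2 * u)
      factor = solve-∀

    module _ (w : Fin v → ℕ) (w-idem : ∀ i → w i * w i ≡ w i)
             (covered : ∀ p i → w i * (x p * N p i) ≡ x p * N p i) where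

      c : ℕ
      c = sum w

      d-on-w : ∀ i → w i * d i ≡ d i
      d-on-w i = trans (*-distribˡ-sum (w i) (λ p → x p * N p i)) (sum-cong-≗ (λ p → covered p i))

      [a*k]²≤c*sum-d² : a * k * (a * k) ≤ c * ∑[ i < v ] (d i * d i)
      [a*k]²≤c*sum-d² = subst (_≤ c * ∑[ i < v ] (d i * d i)) (cong₂ _*_ sum-d sum-d)
        (cauchy-schwarz-on-support w d w-idem d-on-w)

      -- The point p₀ only serves to name the common part size.
      uncovered-bound : (p₀ : Fin v) → k * a * (v ∸ c) ≤ (v ∸ a) * c
      uncovered-bound p₀ = double-counting-arithmetic {n = partSize p₀}
        (m+[n∸m]≡n (sum-idem≤length x-idem)) (m∸n+n≡m (sum-idem≤length w-idem))
        (partSize-equation p₀) [a*k]²≤c*sum-d² sum-d²+2F (partSize*a²≤v*F p₀)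

module _ {v b : ℕ} (Γ : List (Fin v × Fin b)) where

  uncovered : Fin v → ℕ
  uncovered p = 𝟙 (¬? (p ∈ₗ? map proj₁ Γ))

  covered : Fin b → ℕ
  covered i = 𝟙 (i ∈ₗ? map proj₂ Γ)

  ∸-length≤sum-uncovered : v ∸ length Γ ≤ sum uncovered
  ∸-length≤sum-uncovered =
    subst (λ l → v ∸ l ≤ sum uncovered) (length-map proj₁ Γ) (∸-length≤sum-𝟙∉ₗ (map proj₁ Γ))

  ∸-sum-uncovered≤length : v ∸ sum uncovered ≤ length Γ
  ∸-sum-uncovered≤length = ≤-trans (∸-sum-𝟙∉ₗ≤length (map proj₁ Γ)) (≤-reflexive (length-map proj₁ Γ))

  sum-covered≤length : sum covered ≤ length Γ
  sum-covered≤length = ≤-trans (sum-𝟙∈ₗ≤length (map proj₂ Γ)) (≤-reflexive (length-map proj₂ Γ))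

incidence : ∀ {v b} → IncStr v b → Fin v → Fin b → ℕ
incidence D p i = 𝟙 (p ∈? IncStr.blk D i)

module _ {v b : ℕ} (D : IncStr v b) where
  open IncStr D

  pointDeg≡sum : ∀ p → pointDeg D p ≡ ∑[ i < b ] incidence D p i
  pointDeg≡sum p = sum-𝟙-tabulate (λ i → p ∈? blk i) id

  blockSize≡sum : ∀ i → ∣ blk i ∣ ≡ ∑[ p < v ] incidence D p i
  blockSize≡sum i = ∣p∣≡sum-𝟙∈ (blk i)

  commonBlocks≡sum : ∀ p q → commonBlocks D p q ≡ ∑[ i < b ] (incidence D p i * incidence D q i)
  commonBlocks≡sum p q =
    trans (sum-𝟙-tabulate (λ i → (p ∈? blk i) ×-dec (q ∈? blk i)) id)
          (sum-cong-≗ (λ i → 𝟙-×-dec (p ∈? blk i) (q ∈? blk i)))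

  dominated-flag : ∀ {Γ} → IsEdgeDominating D Γ → ∀ {p i} → p ∈ blk i →
    p ∈ₗ map proj₁ Γ ⊎ i ∈ₗ map proj₂ Γ
  dominated-flag (_ , dominating) {p} {i} p∈i with dominating p i p∈i
  ... | _ , _ , e∈Γ , inj₁ refl = inj₁ (∈-map⁺ proj₁ e∈Γ)
  ... | _ , _ , e∈Γ , inj₂ refl = inj₂ (∈-map⁺ proj₂ e∈Γ)

  uncovered-points-lie-on-covered-blocks : ∀ {Γ} → IsEdgeDominating D Γ → ∀ p i →
    covered Γ i * (uncovered Γ p * incidence D p i) ≡ uncovered Γ p * incidence D p i
  uncovered-points-lie-on-covered-blocks {Γ} dominating p i
    with p ∈ₗ? map proj₁ Γ | p ∈? blk i | i ∈ₗ? map proj₂ Γ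
  ... | yes _   | _       | i∈?     = *-zeroʳ (𝟙 i∈?)
  ... | no _    | no _    | i∈?     = *-zeroʳ (𝟙 i∈?)
  ... | no _    | yes _   | yes _   = refl
  ... | no p∉Γ₁ | yes p∈i | no i∉Γ₂ = ⊥-elim ([ p∉Γ₁ , i∉Γ₂ ]′ (dominated-flag dominating p∈i))

module DivisibleSemiBiplane {v m k : ℕ} (D : IncStr v v) (sb : IsSemiBiplane D) (deg : ∀ p → pointDeg D p ≡ k)
  (part : Fin v → Fin m) (divisible : ∀ p q → p ≢ q → (Collinear D p q ⇔ part p ≢ part q)) where
  open IncStr D
  open IsSemiBiplane sb

  same-part⇒no-common-block : ∀ {p q} → p ≢ q → part p ≡ part q →
    ∑[ i < v ] (incidence D p i * incidence D q i) ≡ 0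
  same-part⇒no-common-block {p} {q} p≢q same = trans (sum-cong-≗ no-common) (sum-replicate-zero v)
    where
    no-common : ∀ i → incidence D p i * incidence D q i ≡ 0
    no-common i with p ∈? blk i | q ∈? blk i
    ... | yes p∈i | yes q∈i = contradiction same (Equivalence.to (divisible p q p≢q) (p≢q , i , p∈i , q∈i))
    ... | yes _   | no _    = refl
    ... | no _    | _       = refl

  different-parts⇒two-common-blocks : ∀ {p q} → p ≢ q → part p ≢ part q →
    ∑[ i < v ] (incidence D p i * incidence D q i) ≡ 2
  different-parts⇒two-common-blocks {p} {q} p≢q different
    with Equivalence.from (divisible p q p≢q) different | points-02 p q p≢q
  ... | _ , i , p∈i , q∈i | inj₁ none = contradiction (trans (sym (commonBlocks≡sum D p q)) none) (m<n⇒n≢0 common)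
    where
    common : 0 < ∑[ j < v ] (incidence D p j * incidence D q j)
    common = ≤-trans (≤-reflexive (sym (cong₂ _*_ (𝟙-yes (p ∈? blk i) p∈i) (𝟙-yes (q ∈? blk i) q∈i))))
                     (term≤sum (λ j → incidence D p j * incidence D q j) i)
  ... | _ | inj₂ two = trans (sym (commonBlocks≡sum D p q)) two

  gram : ∀ p q → ∑[ i < v ] (incidence D p i * incidence D q i) + 2 * 𝟙 (part p ≟ part q) ≡ 2 + k * 𝟙 (p ≟ q)
  gram p q with p ≟ q | part p ≟ part q
  ... | yes refl | no differ = contradiction refl differ
  ... | yes refl | yes _ = begin
    ∑[ i < v ] (incidence D p i * incidence D p i) + 2 ≡⟨ cong (_+ 2) (sum-cong-≗ (λ i → 𝟙-idem (p ∈? blk i))) ⟩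
    ∑[ i < v ] incidence D p i + 2                     ≡⟨ cong (_+ 2) (trans (sym (pointDeg≡sum D p)) (deg p)) ⟩
    k + 2                                              ≡⟨ solve (k ∷ []) ⟩
    2 + k * 1                                          ∎
    where open ≡-Reasoning
  ... | no p≢q | yes same =
    trans (cong (_+ 2) (same-part⇒no-common-block p≢q same)) (cong (2 +_) (sym (*-zeroʳ k)))
  ... | no p≢q | no different =
    trans (+-identityʳ _) (trans (different-parts⇒two-common-blocks p≢q different) (cong (2 +_) (sym (*-zeroʳ k))))

corollary6p17 : (v b k : ℕ) (D : IncStr v b) →
    IsSemiBiplane D → HasOrder D k → Divisible D →
    (Γ : List (Fin v × Fin b)) → IsEdgeDominating D Γ →
    k * (v ∸ length Γ) ^ 2 ≤ length Γ ^ 2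
corollary6p17 zero ._ k D _ (refl , _) _ Γ _ =
  subst (λ t → k * t ^ 2 ≤ length Γ ^ 2) (sym (0∸n≡0 (length Γ))) (≤-trans (≤-reflexive (*-zeroʳ k)) z≤n)
corollary6p17 v@(suc _) ._ k D sb (refl , deg , size) (_ , part , divisible) Γ dominating = begin
  k * (v ∸ γ) ^ 2                                  ≡⟨ cong (k *_) (m^2≡m*m (v ∸ γ)) ⟩
  k * ((v ∸ γ) * (v ∸ γ))                          ≡⟨ *-assoc k _ _ ⟨
  k * (v ∸ γ) * (v ∸ γ)                            ≤⟨ *-mono-≤ (*-monoʳ-≤ k (∸-length≤sum-uncovered Γ))
                                                                (∸-monoʳ-≤ v (sum-covered≤length Γ)) ⟩
  k * sum (uncovered Γ) * (v ∸ sum (covered Γ))    ≤⟨ uncovered-bound (uncovered Γ) (λ _ → 𝟙-idem _)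
                                                        (covered Γ) (λ _ → 𝟙-idem _)
                                                        (uncovered-points-lie-on-covered-blocks D dominating) zero ⟩
  (v ∸ sum (uncovered Γ)) * sum (covered Γ)        ≤⟨ *-mono-≤ (∸-sum-uncovered≤length Γ) (sum-covered≤length Γ) ⟩
  γ * γ                                            ≡⟨ m^2≡m*m γ ⟨
  γ ^ 2                                            ∎
  where
  open ≤-Reasoning
  open DivisibleSemiBiplane D sb deg part divisible using (gram)
  open DivisibleIncidenceMatrix (incidence D) part (λ p → trans (sym (pointDeg≡sum D p)) (deg p))
    (λ i → trans (sym (blockSize≡sum D i)) (size i)) gram using (uncovered-bound)
  γ = length Γ
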